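{- Let $n \ge 3$ be a squarefree integer such that there exists an exponential orthomorphism modulo $n$. Then $n$ is either a prime or twice a prime.
   Context: For an integer $n \ge 2$, an exponential orthomorphism modulo $n$ is a permutation $\sigma$ of $\{1, \dots, n-1\}$ such that the map $x \mapsto x^{\sigma(x)} \bmod n$ is also a bijection of $\{1, \dots, n-1\}$. -}

module Defs where

open import Data.Nat using (ℕ; suc; _*_; _^_; _∸_; _≤_; NonZero)
open import Data.Nat.DivMod using (_%_)
open import Data.Nat.Divisibility using (_∣_)
open import Data.Fin using (Fin; toℕ)
open import Data.Product using (Σ; _×_)
open import Function.Definitions using (Bijective)
open import Relation.Binary.PropositionalEquality using (_≡_)

SquareFree : ℕ → Set
SquareFree n = ∀ d → d * d ∣ n → d ≡ 1

-- The element of {1, …, n-1} represented by i : Fin (n ∸ 1).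
elt : ∀ {m} → Fin m → ℕ
elt i = suc (toℕ i)

-- An exponential orthomorphism modulo n: a permutation σ of {1,…,n-1}
-- (encoded on Fin (n ∸ 1) via elt) such that x ↦ x^σ(x) mod n is a
-- bijection of {1,…,n-1}, i.e. equals (via elt) some bijection τ.
ExpOrthomorphism : (n : ℕ) → .{{NonZero n}} → Set
ExpOrthomorphism n =
  Σ (Fin (n ∸ 1) → Fin (n ∸ 1)) λ σ →
  Σ (Fin (n ∸ 1) → Fin (n ∸ 1)) λ τ →
    Bijective _≡_ _≡_ σ × Bijective _≡_ _≡_ τ ×
    (∀ x → (elt x ^ elt (σ x)) % n ≡ elt (τ x))

module Submission where

-- Suppose n = a·b with coprime a, b ≥ 3 carries an
-- exponential orthomorphism (σ, τ).  Choosing x with σ(x) = 2k for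
-- k = 1, …, ⌊n/2⌋ - 1 gives τ(x) = (x^k)², so the orthomorphism exhibits
-- ⌊n/2⌋ - 1 pairwise distinct nonzero squares modulo n.  On the other
-- hand every residue y agrees up to sign with its fold
-- min(y mod n, n - y mod n) ∈ {0, …, ⌊n/2⌋}, and y² depends only on the
-- fold, so nonzero squares are counted by folds in {1, …, ⌊n/2⌋}.  By
-- the Chinese remainder theorem there is e ≡ 1 (mod a), e ≡ -1 (mod b);
-- then 1 and 4 each have two roots (1, e) and (2, 2e) with different
-- folds, so at most ⌊n/2⌋ - 2 nonzero squares exist: a contradiction.

open import Defs
open import Data.Nat using (ℕ; zero; suc; _+_; _*_; _∸_; _^_; _≤_; _<_; _⊓_; ⌊_/2⌋; pred; NonZero; ≢-nonZero; >-nonZero; >-nonZero⁻¹; s≤s; z≤n; nonTrivial⇒n>1; n>1⇒nonTrivial)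
open import Data.Nat.Properties
open import Data.Nat.DivMod using (_%_; %-distribˡ-+; %-distribˡ-*; [m+kn]%n≡m%n; m*n%n≡0; m%n≤n; m<n⇒m%n≡m; n%n≡0; m∣n⇒o%n%m≡o%m)
open import Data.Nat.Divisibility using (_∣_; divides; ∣-refl; ∣-trans; ∣⇒≤; *-pres-∣; m%n≡0⇒n∣m)
open import Data.Nat.Primality using (Prime; prime?; ¬prime⇒composite)
open import Data.Nat.Divisibility.Core using (hasNonTrivialDivisor)
open import Data.Nat.Coprimality using (Coprime; coprime-Bézout)
open import Data.Nat.GCD using (module Bézout)
open import Data.Nat.Tactic.RingSolver using (solve-∀)
import Data.Fin as Fin
open import Data.Fin using (Fin; toℕ; fromℕ<)
open import Data.Fin.Properties using (toℕ-fromℕ<; toℕ-injective; toℕ<n; injective⇒≤; any?)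
open import Data.Vec.Functional using (_∷_)
open import Data.Product using (Σ; _×_; _,_; proj₁; proj₂)
open import Data.Sum using (_⊎_; inj₁; inj₂; [_,_])
open import Data.Empty using (⊥-elim)
open import Function using (_∘_)
open import Function.Definitions using (Injective)
open import Relation.Nullary using (¬_; Dec; yes; no; contradiction)
open import Relation.Binary.PropositionalEquality using (_≡_; _≢_; refl; sym; trans; cong; subst; module ≡-Reasoning)

double-injective : ∀ {m k} → m + m ≡ k + k → m ≡ k
double-injective {m} {k} eq = trans (n≡⌊n+n/2⌋ m) (trans (cong ⌊_/2⌋ eq) (sym (n≡⌊n+n/2⌋ k)))

mod-divisor : ∀ {n d} .{{_ : NonZero n}} .{{_ : NonZero d}} → d ∣ n →
              ∀ {x y} → x % n ≡ y % n → x % d ≡ y % d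
mod-divisor {n} {d} d∣n {x} {y} eq =
  trans (sym (m∣n⇒o%n%m≡o%m d n x d∣n)) (trans (cong (_% d) eq) (m∣n⇒o%n%m≡o%m d n y d∣n))

module Residues (n : ℕ) .{{_ : NonZero n}} where

  square : ℕ → ℕ
  square y = (y * y) % n

  -- The fold of y: the least absolute value of a representative of y
  -- modulo n.  It lies in {0, …, ⌊n/2⌋} and determines y up to sign.
  fold : ℕ → ℕ
  fold y = (y % n) ⊓ (n ∸ y % n)

  square-mod : ∀ y → square (y % n) ≡ square y
  square-mod y = sym (%-distribˡ-* y y n)

  square-neg : ∀ {r} → r ≤ n → square (n ∸ r) ≡ square r
  square-neg {r} r≤n = begin
      (t * t) % n                ≡⟨ sym ([m+kn]%n≡m%n (t * t) r n) ⟩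
      (t * t + r * n) % n        ≡⟨ cong (λ z → (t * t + r * z) % n) (sym t+r≡n) ⟩
      (t * t + r * (t + r)) % n  ≡⟨ cong (_% n) (exchange t r) ⟩
      (r * r + t * (t + r)) % n  ≡⟨ cong (λ z → (r * r + t * z) % n) t+r≡n ⟩
      (r * r + t * n) % n        ≡⟨ [m+kn]%n≡m%n (r * r) t n ⟩
      (r * r) % n                ∎
    where
    open ≡-Reasoning
    t = n ∸ r
    t+r≡n : t + r ≡ n
    t+r≡n = m∸n+n≡m r≤n
    exchange : ∀ t r → t * t + r * (t + r) ≡ r * r + t * (t + r)
    exchange = solve-∀

  fold-cases : ∀ y → fold y ≡ y % n ⊎ fold y + y % n ≡ n
  fold-cases y with ⊓-sel (y % n) (n ∸ y % n)
  ... | inj₁ eq = inj₁ eq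
  ... | inj₂ eq = inj₂ (trans (cong (_+ y % n) eq) (m∸n+n≡m (m%n≤n y n)))

  fold-square : ∀ y → square (fold y) ≡ square y
  fold-square y with fold-cases y
  ... | inj₁ eq = trans (cong square eq) (square-mod y)
  ... | inj₂ eq = begin
      square (fold y)                 ≡⟨ cong square (sym (m+n∸n≡m (fold y) (y % n))) ⟩
      square (fold y + y % n ∸ y % n) ≡⟨ cong (λ z → square (z ∸ y % n)) eq ⟩
      square (n ∸ y % n)              ≡⟨ square-neg (m%n≤n y n) ⟩
      square (y % n)                  ≡⟨ square-mod y ⟩
      square y                        ∎
    where open ≡-Reasoning

  fold-≡⇒square-≡ : ∀ {y z} → fold y ≡ fold z → square y ≡ square z
  fold-≡⇒square-≡ {y} {z} eq = trans (sym (fold-square y)) (trans (cong square eq) (fold-square z))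

  fold-nonzero : ∀ {y} → square y ≢ 0 → fold y ≢ 0
  fold-nonzero {y} sq≢0 fold≡0 =
    sq≢0 (trans (sym (fold-square y)) (trans (cong square fold≡0) (m*n%n≡0 0 n)))

  fold-≤-half : ∀ y → fold y ≤ ⌊ n /2⌋
  fold-≤-half y = ≤-trans (≤-reflexive (n≡⌊n+n/2⌋ (fold y))) (⌊n/2⌋-mono fold+fold≤n)
    where
    fold+fold≤n : fold y + fold y ≤ n
    fold+fold≤n = ≤-trans (+-mono-≤ (m⊓n≤m (y % n) (n ∸ y % n)) (m⊓n≤n (y % n) (n ∸ y % n)))
                          (≤-reflexive (m+[n∸m]≡n (m%n≤n y n)))

  opposite : ∀ {y z} → y % n + z % n ≡ n → (y + z) % n ≡ 0
  opposite {y} {z} sum≡n = trans (%-distribˡ-+ y z n) (trans (cong (_% n) sum≡n) (n%n≡0 n))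

  fold-sign : ∀ {y z} → fold y ≡ fold z → y % n ≡ z % n ⊎ (y + z) % n ≡ 0
  fold-sign {y} {z} eq with fold-cases y | fold-cases z
  ... | inj₁ fy | inj₁ fz = inj₁ (trans (sym fy) (trans eq fz))
  ... | inj₁ fy | inj₂ fz = inj₂ (opposite (trans (cong (_+ z % n) (trans (sym fy) eq)) fz))
  ... | inj₂ fy | inj₁ fz = inj₂ (opposite (trans (+-comm (y % n) (z % n)) (trans (cong (_+ y % n) (trans (sym fz) (sym eq))) fy)))
  ... | inj₂ fy | inj₂ fz = inj₁ (+-cancelˡ-≡ (fold y) (y % n) (z % n) (trans fy (trans (sym fz) (cong (_+ z % n) (sym eq)))))

  record DistinctSquares (K : ℕ) : Set where
    field
      root     : Fin K → ℕ
      nonzero  : ∀ j → square (root j) ≢ 0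
      distinct : ∀ {i j} → square (root i) ≡ square (root j) → i ≡ j

  -- A square class s with two roots of different fold, i.e. two roots
  -- that are not negatives of each other.
  record DoubleRoot (s : ℕ) : Set where
    field
      root₁ root₂   : ℕ
      root₁-square  : square root₁ ≡ s
      root₂-square  : square root₂ ≡ s
      folds-differ  : fold root₁ ≢ fold root₂

  FoldInjective : ∀ {m} → (Fin m → ℕ) → Set
  FoldInjective g = Injective _≡_ _≡_ (fold ∘ g)

  fold-injective-bound : ∀ {m} (g : Fin m → ℕ) → (∀ i → square (g i) ≢ 0) →
                         FoldInjective g → m ≤ ⌊ n /2⌋
  fold-injective-bound {m} g nonzero g-inj = injective⇒≤ index-injective
    where
    suc-pred-fold : ∀ i → suc (pred (fold (g i))) ≡ fold (g i)
    suc-pred-fold i = suc-pred (fold (g i)) {{≢-nonZero (fold-nonzero (nonzero i))}}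
    index : Fin m → Fin ⌊ n /2⌋
    index i = fromℕ< (≤-trans (≤-reflexive (suc-pred-fold i)) (fold-≤-half (g i)))
    index-injective : Injective _≡_ _≡_ index
    index-injective {i} {j} eq = g-inj (begin
        fold (g i)              ≡⟨ sym (suc-pred-fold i) ⟩
        suc (pred (fold (g i))) ≡⟨ cong suc (trans (sym (toℕ-fromℕ< _)) (trans (cong toℕ eq) (toℕ-fromℕ< _))) ⟩
        suc (pred (fold (g j))) ≡⟨ suc-pred-fold j ⟩
        fold (g j)              ∎)
      where open ≡-Reasoning

  fold-injective-∷ : ∀ {m} {g : Fin m → ℕ} {w} → FoldInjective g →
                     (∀ j → fold w ≢ fold (g j)) → FoldInjective (w ∷ g)
  fold-injective-∷ g-inj new {Fin.zero}  {Fin.zero}  eq = refl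
  fold-injective-∷ g-inj new {Fin.zero}  {Fin.suc j} eq = ⊥-elim (new j eq)
  fold-injective-∷ g-inj new {Fin.suc i} {Fin.zero}  eq = ⊥-elim (new i (sym eq))
  fold-injective-∷ g-inj new {Fin.suc i} {Fin.suc j} eq = cong Fin.suc (g-inj eq)

  module _ {K} (D : DistinctSquares K) where
    open DistinctSquares D

    roots-fold-injective : FoldInjective root
    roots-fold-injective = distinct ∘ fold-≡⇒square-≡

    -- Of the two roots of a double root, one has a fold not used by the
    -- family: if both folds were used, by roots of the same square and
    -- hence by the same root, the two folds would coincide.
    new-root : ∀ {s} → DoubleRoot s →
               Σ ℕ λ w → square w ≡ s × (∀ j → fold w ≢ fold (root j))
    new-root {s} R = choose (any? (λ j → fold (root j) ≟ fold root₁)) (any? (λ j → fold (root j) ≟ fold root₂))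
      where
      open DoubleRoot R
      Used : ℕ → Set
      Used w = Σ (Fin K) λ j → fold (root j) ≡ fold w
      choose : Dec (Used root₁) → Dec (Used root₂) →
               Σ ℕ λ w → square w ≡ s × (∀ j → fold w ≢ fold (root j))
      choose (no unused) _           = root₁ , root₁-square , λ j eq → unused (j , sym eq)
      choose (yes _)     (no unused) = root₂ , root₂-square , λ j eq → unused (j , sym eq)
      choose (yes (i , hit)) (yes (j , hit′)) =
        ⊥-elim (folds-differ (trans (sym hit) (trans (cong (fold ∘ root) i≡j) hit′)))
        where
        i≡j : i ≡ j
        i≡j = distinct (trans (fold-≡⇒square-≡ hit)
                         (trans root₁-square (trans (sym root₂-square) (sym (fold-≡⇒square-≡ hit′)))))

    square-count : ∀ {s t} → DoubleRoot s → DoubleRoot t → s ≢ 0 → t ≢ 0 → s ≢ t →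
                   2 + K ≤ ⌊ n /2⌋
    square-count {s} {t} Rs Rt s≢0 t≢0 s≢t =
      fold-injective-bound (u ∷ (w ∷ root)) nonzero-all
        (fold-injective-∷ (fold-injective-∷ roots-fold-injective w-new) u-new)
      where
      u = proj₁ (new-root Rs)
      w = proj₁ (new-root Rt)
      u² = proj₁ (proj₂ (new-root Rs))
      w² = proj₁ (proj₂ (new-root Rt))
      u-unused = proj₂ (proj₂ (new-root Rs))
      w-new = proj₂ (proj₂ (new-root Rt))
      -- u is new also with respect to w, as their squares s and t differ
      u-new : ∀ j → fold u ≢ fold ((w ∷ root) j)
      u-new Fin.zero    eq = s≢t (trans (sym u²) (trans (fold-≡⇒square-≡ eq) w²))
      u-new (Fin.suc j)    = u-unused j
      nonzero-all : ∀ i → square ((u ∷ (w ∷ root)) i) ≢ 0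
      nonzero-all Fin.zero             = s≢0 ∘ trans (sym u²)
      nonzero-all (Fin.suc Fin.zero)    = t≢0 ∘ trans (sym w²)
      nonzero-all (Fin.suc (Fin.suc j)) = nonzero j

-- An exponential orthomorphism modulo n exhibits K distinct nonzero squares
-- whenever 2K < n: if σ(x_j) = 2(j+1) then τ(x_j) = (x_j^(j+1))² mod n,
-- which is nonzero, and injectivity of τ separates these squares.
orthomorphism-squares : ∀ n .{{_ : NonZero n}} → ExpOrthomorphism n →
                        ∀ K → K + K < n → Residues.DistinctSquares n K
orthomorphism-squares n (σ , τ , (_ , σ-surjective) , (τ-injective , _) , power) K 2K<n =
  record { root = root ; nonzero = nonzero ; distinct = distinct }
  where
  open Residues n using (square)

  exponent-bound : ∀ (j : Fin K) → toℕ j + suc (toℕ j) < n ∸ 1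
  exponent-bound j = ≤-trans (+-mono-≤ (toℕ<n j) (toℕ<n j)) (∸-monoˡ-≤ 1 2K<n)
  exponent : Fin K → Fin (n ∸ 1)
  exponent j = fromℕ< (exponent-bound j)
  elt-exponent : ∀ j → elt (exponent j) ≡ suc (toℕ j) + suc (toℕ j)
  elt-exponent j = cong suc (toℕ-fromℕ< (exponent-bound j))

  base : Fin K → Fin (n ∸ 1)
  base j = proj₁ (σ-surjective (exponent j))
  elt-σ-base : ∀ j → elt (σ (base j)) ≡ suc (toℕ j) + suc (toℕ j)
  elt-σ-base j = trans (cong elt (proj₂ (σ-surjective (exponent j)) refl)) (elt-exponent j)
  root : Fin K → ℕ
  root j = elt (base j) ^ suc (toℕ j)

  root-square : ∀ j → square (root j) ≡ elt (τ (base j))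
  root-square j = begin
      (x ^ k * x ^ k) % n         ≡⟨ cong (_% n) (sym (^-distribˡ-+-* x k k)) ⟩
      (x ^ (k + k)) % n           ≡⟨ cong (λ e → (x ^ e) % n) (sym (elt-σ-base j)) ⟩
      (x ^ elt (σ (base j))) % n  ≡⟨ power (base j) ⟩
      elt (τ (base j))            ∎
    where
    open ≡-Reasoning
    x = elt (base j)
    k = suc (toℕ j)

  nonzero : ∀ j → square (root j) ≢ 0
  nonzero j eq = 0≢1+n (trans (sym eq) (root-square j))

  distinct : ∀ {i j} → square (root i) ≡ square (root j) → i ≡ j
  distinct {i} {j} eq = toℕ-injective (suc-injective (double-injective exponents))
    where
    same-τ : τ (base i) ≡ τ (base j)
    same-τ = toℕ-injective (suc-injective (trans (sym (root-square i)) (trans eq (root-square j))))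
    exponents : suc (toℕ i) + suc (toℕ i) ≡ suc (toℕ j) + suc (toℕ j)
    exponents = trans (sym (elt-σ-base i)) (trans (cong (elt ∘ σ) (τ-injective same-τ)) (elt-σ-base j))

-- e = 1 + k·a with e + 1 = l·b: an element that is 1 modulo a and -1
-- modulo b, hence a square root of unity modulo a·b.
SplitUnit : ℕ → ℕ → Set
SplitUnit a b = Σ ℕ λ k → Σ ℕ λ l → 2 + k * a ≡ l * b

-- Doubling a Bézout identity 1 + x·a = y·b yields a split unit.
doubled : ∀ x a y b → 1 + x * a ≡ y * b → 2 + 2 * x * a ≡ 2 * y * b
doubled x a y b eq = trans (expand x a) (trans (cong (2 *_) eq) (reassociate y b))
  where
  expand : ∀ x a → 2 + 2 * x * a ≡ 2 * (1 + x * a)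
  expand = solve-∀
  reassociate : ∀ y b → 2 * (y * b) ≡ 2 * y * b
  reassociate = solve-∀

split-unit : ∀ {a b} → Coprime a b → SplitUnit a b ⊎ SplitUnit b a
split-unit {a} {b} a⊥b with coprime-Bézout a⊥b
... | Bézout.-+ x y eq = inj₁ (2 * x , 2 * y , doubled x a y b eq)
... | Bézout.+- x y eq = inj₂ (2 * y , 2 * x , doubled y b x a eq)

-- Multiplying by a split unit e of n = a·b preserves squares but moves
-- the fold of v, unless a or b divides 2v.
module SplitUnitModulo (n a b : ℕ) .{{_ : NonZero n}} .{{_ : NonZero a}} .{{_ : NonZero b}}
  (a*b≡n : a * b ≡ n) (k l : ℕ) (split : 2 + k * a ≡ l * b) where

  open Residues n

  e : ℕ
  e = 1 + k * a

  -- e² = 1 + kl·n, so multiplying by e preserves squares.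
  square-*e : ∀ v → square (v * e) ≡ square v
  square-*e v = begin
      (v * e * (v * e)) % n                    ≡⟨ cong (_% n) (expand v k a) ⟩
      (v * v + v * v * k * a * (2 + k * a)) % n ≡⟨ cong (λ m → (v * v + v * v * k * a * m) % n) split ⟩
      (v * v + v * v * k * a * (l * b)) % n    ≡⟨ cong (λ m → (v * v + m) % n) (regroup v k a l b) ⟩
      (v * v + v * v * k * l * (a * b)) % n    ≡⟨ cong (λ m → (v * v + v * v * k * l * m) % n) a*b≡n ⟩
      (v * v + v * v * k * l * n) % n          ≡⟨ [m+kn]%n≡m%n (v * v) (v * v * k * l) n ⟩
      (v * v) % n                              ∎
    where
    open ≡-Reasoning
    expand : ∀ v k a → v * (1 + k * a) * (v * (1 + k * a)) ≡ v * v + v * v * k * a * (2 + k * a)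
    expand = solve-∀
    regroup : ∀ v k a l b → v * v * k * a * (l * b) ≡ v * v * k * l * (a * b)
    regroup = solve-∀

  a∣n : a ∣ n
  a∣n = divides b (trans (sym a*b≡n) (*-comm a b))

  b∣n : b ∣ n
  b∣n = divides a (sym a*b≡n)

  -- Modulo b, v + v·e ≡ 0 (as e ≡ -1), so v ≡ v·e forces b ∣ 2v;
  -- modulo a, v + v·e ≡ 2v (as e ≡ 1), so v ≡ -v·e forces a ∣ 2v.
  separates : ∀ v → fold v ≡ fold (v * e) → a ∣ v + v ⊎ b ∣ v + v
  separates v eq with fold-sign eq
  ... | inj₁ same = inj₂ (m%n≡0⇒n∣m (v + v) b (begin
      (v + v) % b               ≡⟨ %-distribˡ-+ v v b ⟩
      (v % b + v % b) % b       ≡⟨ cong (λ z → (v % b + z) % b) (mod-divisor b∣n same) ⟩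
      (v % b + v * e % b) % b   ≡⟨ sym (%-distribˡ-+ v (v * e) b) ⟩
      (v + v * e) % b           ≡⟨ cong (_% b) (trans (v+v*e v k a) (cong (v *_) split)) ⟩
      (v * (l * b)) % b         ≡⟨ cong (_% b) (sym (*-assoc v l b)) ⟩
      (v * l * b) % b           ≡⟨ m*n%n≡0 (v * l) b ⟩
      0                         ∎))
    where
    open ≡-Reasoning
    v+v*e : ∀ v k a → v + v * (1 + k * a) ≡ v * (2 + k * a)
    v+v*e = solve-∀
  ... | inj₂ sum≡0 = inj₁ (m%n≡0⇒n∣m (v + v) a (begin
      (v + v) % a               ≡⟨ sym ([m+kn]%n≡m%n (v + v) (v * k) a) ⟩
      (v + v + v * k * a) % a   ≡⟨ cong (_% a) (v+v+v*k*a v k a) ⟩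
      (v + v * e) % a           ≡⟨ mod-divisor a∣n (trans sum≡0 (sym (m*n%n≡0 0 n))) ⟩
      0 % a                     ≡⟨ m*n%n≡0 0 a ⟩
      0                         ∎))
    where
    open ≡-Reasoning
    v+v+v*k*a : ∀ v k a → v + v + v * k * a ≡ v + v * (1 + k * a)
    v+v+v*k*a = solve-∀

  double-root : ∀ v → ¬ a ∣ v + v → ¬ b ∣ v + v → DoubleRoot (square v)
  double-root v a∤2v b∤2v = record
    { root₁ = v ; root₂ = v * e
    ; root₁-square = refl ; root₂-square = square-*e v
    ; folds-differ = λ eq → [ a∤2v , b∤2v ] (separates v eq) }

squarefree-coprime : ∀ {n a b} → SquareFree n → a * b ≡ n → Coprime a b
squarefree-coprime {n} {a} {b} sf a*b≡n {d} (d∣a , d∣b) =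
  sf d (subst (d * d ∣_) a*b≡n (*-pres-∣ d∣a d∣b))

-- A divisor d ≥ 3 of a squarefree number does not divide 4: it would be
-- 4 = 2² itself.
large-divisor-∤-4 : ∀ {n d} → SquareFree n → d ∣ n → 3 ≤ d → ¬ d ∣ 4
large-divisor-∤-4 {d = 0} _ _ () _
large-divisor-∤-4 {d = 1} _ _ (s≤s ()) _
large-divisor-∤-4 {d = 2} _ _ (s≤s (s≤s ())) _
large-divisor-∤-4 {d = 3} _ _ _ (divides (suc (suc (suc _))) ())
large-divisor-∤-4 {d = 4} sf 4∣n _ _ = contradiction (sf 2 4∣n) λ ()
large-divisor-∤-4 {d = suc (suc (suc (suc (suc _))))} _ _ _ d∣4 =
  contradiction (∣⇒≤ d∣4) λ { (s≤s (s≤s (s≤s (s≤s ())))) }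

no-room : ∀ h → ¬ 2 + pred h ≤ h
no-room zero ()
no-room (suc h) le = 1+n≰n (≤-pred le)

pred-half-double : ∀ n .{{_ : NonZero n}} → pred ⌊ n /2⌋ + pred ⌊ n /2⌋ < n
pred-half-double n = bound ⌊ n /2⌋ half+half≤n
  where
  half+half≤n : ⌊ n /2⌋ + ⌊ n /2⌋ ≤ n
  half+half≤n = ≤-trans (+-monoʳ-≤ ⌊ n /2⌋ (⌊n/2⌋≤⌈n/2⌉ n)) (≤-reflexive (⌊n/2⌋+⌈n/2⌉≡n n))
  bound : ∀ h → h + h ≤ n → pred h + pred h < n
  bound zero    _  = >-nonZero⁻¹ n
  bound (suc h) le = ≤-trans (s≤s (+-monoʳ-≤ h (n≤1+n h))) le

-- Given a split unit for (a, b), where n = a·b is squarefree and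
-- a, b ≥ 3, the orthomorphism gives ⌊n/2⌋ - 1 distinct nonzero squares,
-- while the double roots (1, e) of 1 and (2, 2e) of 4 leave room for at
-- most ⌊n/2⌋ - 2 of them.
split-no-orthomorphism : ∀ {n a b} .{{_ : NonZero n}} → SquareFree n → 3 ≤ a → 3 ≤ b →
                         a * b ≡ n → SplitUnit a b → ¬ ExpOrthomorphism n
split-no-orthomorphism {n} {a} {b} sf 3≤a 3≤b a*b≡n (k , l , split) orth =
  no-room ⌊ n /2⌋ (square-count squares (double-root-of 1 (divides 2 refl)) (double-root-of 2 ∣-refl)
                     (λ eq → 0≢1+n (trans (sym eq) square-1))
                     (λ eq → 0≢1+n (trans (sym eq) square-2))
                     (λ eq → 1≢4 (trans (sym square-1) (trans eq square-2))))
  where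
  instance
    a≢0 : NonZero a
    a≢0 = >-nonZero (≤-trans (s≤s z≤n) 3≤a)
    b≢0 : NonZero b
    b≢0 = >-nonZero (≤-trans (s≤s z≤n) 3≤b)
  open Residues n
  open SplitUnitModulo n a b a*b≡n k l split

  squares : DistinctSquares (pred ⌊ n /2⌋)
  squares = orthomorphism-squares n orth (pred ⌊ n /2⌋) (pred-half-double n)

  double-root-of : ∀ v → v + v ∣ 4 → DoubleRoot (square v)
  double-root-of v 2v∣4 = double-root v (large-∤ a∣n 3≤a) (large-∤ b∣n 3≤b)
    where
    large-∤ : ∀ {d} → d ∣ n → 3 ≤ d → ¬ d ∣ v + v
    large-∤ d∣n 3≤d d∣2v = large-divisor-∤-4 sf d∣n 3≤d (∣-trans d∣2v 2v∣4)

  9≤n : 9 ≤ n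
  9≤n = ≤-trans (*-mono-≤ 3≤a 3≤b) (≤-reflexive a*b≡n)
  square-1 : square 1 ≡ 1
  square-1 = m<n⇒m%n≡m (≤-trans (s≤s (s≤s z≤n)) 9≤n)
  square-2 : square 2 ≡ 4
  square-2 = m<n⇒m%n≡m (≤-trans (s≤s (s≤s (s≤s (s≤s (s≤s z≤n))))) 9≤n)
  1≢4 : 1 ≢ 4
  1≢4 ()

no-orthomorphism : ∀ {n a b} .{{_ : NonZero n}} → SquareFree n → 3 ≤ a → 3 ≤ b →
                   a * b ≡ n → ¬ ExpOrthomorphism n
no-orthomorphism {n} {a} {b} sf 3≤a 3≤b a*b≡n =
  [ split-no-orthomorphism sf 3≤a 3≤b a*b≡n
  , split-no-orthomorphism sf 3≤b 3≤a (trans (*-comm b a) a*b≡n) ]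
  (split-unit (squarefree-coprime sf a*b≡n))

composite-factors : ∀ {m} → 2 ≤ m → ¬ Prime m →
                    Σ ℕ λ d → Σ ℕ λ q → 2 ≤ d × 2 ≤ q × q * d ≡ m
composite-factors {m} 2≤m ¬prime with ¬prime⇒composite {{n>1⇒nonTrivial 2≤m}} ¬prime
... | hasNonTrivialDivisor {d} d<m (divides q m≡q*d) =
  d , q , nonTrivial⇒n>1 d , cofactor-≥2 q m≡q*d , sym m≡q*d
  where
  cofactor-≥2 : ∀ q → m ≡ q * d → 2 ≤ q
  cofactor-≥2 zero          m≡0 = contradiction (≤-trans 2≤m (≤-reflexive m≡0)) λ ()
  cofactor-≥2 (suc zero)    m≡d = ⊥-elim (<-irrefl (sym (trans m≡d (+-identityʳ d))) d<m)
  cofactor-≥2 (suc (suc q)) _   = s≤s (s≤s z≤n)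

two-or-more : ∀ {d} → 2 ≤ d → d ≡ 2 ⊎ 3 ≤ d
two-or-more {suc zero}          (s≤s ())
two-or-more {suc (suc zero)}    _ = inj₁ refl
two-or-more {suc (suc (suc _))} _ = inj₂ (s≤s (s≤s (s≤s z≤n)))

TwicePrime : ℕ → Set
TwicePrime n = Σ ℕ λ p → Prime p × n ≡ 2 * p

LargeFactors : ℕ → Set
LargeFactors n = Σ ℕ λ a → Σ ℕ λ b → 3 ≤ a × 3 ≤ b × a * b ≡ n

-- For squarefree n = 2r with r ≥ 2: either r is prime, or r = q·d with
-- q, d ≥ 2, and then q ≠ 2 since 4 ∤ n, so n = (2d)·q with 2d, q ≥ 3.
twice-shape : ∀ {n r} → SquareFree n → 2 ≤ r → 2 * r ≡ n → TwicePrime n ⊎ LargeFactors n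
twice-shape {n} {r} sf 2≤r 2r≡n with prime? r
... | yes r-prime = inj₁ (r , r-prime , sym 2r≡n)
... | no ¬prime with composite-factors 2≤r ¬prime
...   | d , q , 2≤d , 2≤q , qd≡r with two-or-more 2≤q
...     | inj₁ refl = contradiction (sf 2 (divides d (trans (sym 2r≡n) (trans (cong (2 *_) (sym qd≡r)) (four-divides d))))) λ ()
  where
  four-divides : ∀ d → 2 * (2 * d) ≡ d * (2 * 2)
  four-divides = solve-∀
...     | inj₂ 3≤q = inj₂ (2 * d , q , ≤-trans (n≤1+n 3) (*-monoʳ-≤ 2 2≤d) , 3≤q ,
                           trans (regroup d q) (trans (cong (2 *_) qd≡r) 2r≡n))
  where
  regroup : ∀ d q → 2 * d * q ≡ 2 * (q * d)
  regroup = solve-∀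

non-prime-shape : ∀ {n} → 3 ≤ n → SquareFree n → ¬ Prime n → TwicePrime n ⊎ LargeFactors n
non-prime-shape 3≤n sf ¬prime with composite-factors (≤-trans (n≤1+n 2) 3≤n) ¬prime
... | d , q , 2≤d , 2≤q , qd≡n with two-or-more 2≤d | two-or-more 2≤q
...   | inj₁ refl | _         = twice-shape sf 2≤q (trans (*-comm 2 q) qd≡n)
...   | inj₂ _    | inj₁ refl = twice-shape sf 2≤d qd≡n
...   | inj₂ 3≤d  | inj₂ 3≤q  = inj₂ (q , d , 3≤q , 3≤d , qd≡n)

proposition3p2 : (n : ℕ) → .{{_ : NonZero n}} → 3 ≤ n → SquareFree n →
    ExpOrthomorphism n → Prime n ⊎ Σ ℕ (λ p → Prime p × n ≡ 2 * p)
proposition3p2 n 3≤n sf orth with prime? n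
... | yes n-prime = inj₁ n-prime
... | no ¬prime with non-prime-shape 3≤n sf ¬prime
...   | inj₁ twice-prime = inj₂ twice-prime
...   | inj₂ (a , b , 3≤a , 3≤b , a*b≡n) = ⊥-elim (no-orthomorphism sf 3≤a 3≤b a*b≡n orth)
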